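{- Let $G=(V,E)$ be a finite simple graph with $|V| \ge 3$, let $v_0 \in V$ with $\deg(v_0) = |V|-1$, and let $g: V \rightarrow \mathbb N_0$ be such that $g(u) \neq g(v)$ for every edge $\{u,v\} \in E(N(v_0))$. Then there exists a function $h: E \rightarrow \{0, 1, 2\}$ such that (i) $h(\{u,v\}) \in \{0,1\}$ whenever $v_0 \notin \{u,v\}$ and $g(u)+ g(v)$ is even; (ii) $h(\{u,v\})=0$ whenever $v_0 \notin \{u,v\}$ and $g(u) + g(v)$ is odd; (iii) $s_h(v) := \sum_{w \in N(v)} h(\{v,w\}) \in \{0,2\}$ for all $v \in N(v_0)$; and (iv) $g(u)+s_h(u) \neq g(v) + s_h(v)$ for every edge $\{u,v\} \in E$.
   Context: $N(v)$ denotes the neighborhood of $v$ in $G$; $E(X)$ denotes the edge set of the induced subgraph $G[X]$ for $X\subseteq V$; $\mathbb N_0$ is the set of nonnegative integers. -}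

module Defs where

open import Data.Nat using (ℕ; _+_)
open import Data.Bool using (Bool; true; false; if_then_else_)
open import Data.Fin using (Fin; toℕ)
open import Data.List using (map; allFin)
open import Data.Nat.ListAction using (sum)
open import Relation.Binary.PropositionalEquality using (_≡_)

record Graph (n : ℕ) : Set where
  field
    adj    : Fin n → Fin n → Bool
    adj-sym : ∀ u v → adj u v ≡ adj v u
    adj-irrefl : ∀ v → adj v v ≡ false
open Graph public

deg : ∀ {n} → Graph n → Fin n → ℕ
deg {n} G v = sum (map (λ w → if adj G v w then 1 else 0) (allFin n))

-- s_h(v) = Σ_{w ∈ N(v)} h({v,w}), with h given on ordered pairs (symmetric on edges)
sh : ∀ {n} → Graph n → (Fin n → Fin n → Fin 3) → Fin n → ℕ
sh {n} G h v = sum (map (λ w → if adj G v w then toℕ (h v w) else 0) (allFin n))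

-- Every vertex w ≠ v₀ is adjacent to v₀, so h may put weight 2 on the spoke v₀w for the
-- vertices w of a chosen set In ⊆ N(v₀) and 0 everywhere else: then s_h is 2 on In, 0 on
-- N(v₀) ∖ In and 2|In| at v₀.  If In is an upper segment of N(v₀) sorted by g, raising it
-- by 2 cannot create a collision inside N(v₀), and a pigeonhole argument on the sorted
-- values finds a segment for which g(v₀) + 2|In| is hit by no vertex either — except in
-- one configuration: a vertex w with g(w) = g(v₀) + 2·#{vertices above w}, strictly
-- between its neighbours in the order, with successor w′.  There the set (upper segment
-- from w) ∖ {w′} works, unless ww′ is an edge with g(w′) = g(w) + 2; in that case the
-- segment from w is used with weight 1 on the spokes v₀w, v₀w′ and on the edge ww′.
module Submission where

open import Defs
open import Data.Bool using (Bool; true; false; if_then_else_)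
import Data.Bool as Bool
open import Data.Bool.Properties using (if-eta; ∨-zeroʳ)
open import Data.Empty using (⊥; ⊥-elim)
open import Data.Fin using (Fin; zero; suc; toℕ; _≟_)
open import Data.Fin.Patterns using (0F; 1F; 2F)
open import Data.Fin.Properties using (≡-setoid)
open import Data.List using (List; []; _∷_; _++_; [_]; length; map; allFin; tabulate; filter; take; drop)
open import Data.List.Properties using (map-tabulate; ++-assoc; length-++; length-drop; take++drop≡id)
open import Data.List.Membership.Propositional using (_∈_; _∉_)
open import Data.List.Membership.Propositional.Properties using (∈-++⁺ʳ; ∈-++⁻; ∈-filter⁺; ∈-filter⁻; ∈-allFin)
open import Data.List.Relation.Binary.Permutation.Propositional using (↭-sym; ↭⇒↭ₛ)
open import Data.List.Relation.Binary.Permutation.Propositional.Properties using (∈-resp-↭)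
import Data.List.Relation.Binary.Permutation.Setoid.Properties as PermutationProperties
open import Data.List.Relation.Unary.All using (All; []; _∷_)
import Data.List.Relation.Unary.All as All
import Data.List.Relation.Unary.All.Properties as All
open import Data.List.Relation.Unary.AllPairs using (AllPairs; []; _∷_)
import Data.List.Relation.Unary.AllPairs as AllPairs
open import Data.List.Relation.Unary.Any using (here; there)
import Data.List.Relation.Unary.Sorted.TotalOrder.Properties as SortedProperties
open import Data.List.Relation.Unary.Unique.Propositional using (Unique)
import Data.List.Relation.Unary.Unique.Propositional.Properties as Unique
open import Data.Nat using (ℕ; zero; suc; _+_; _*_; _≤_; _<_; _∸_; _%_; z≤n; s≤s; z<s; _<?_)
import Data.Nat as ℕ
open import Data.Nat.DivMod using (m*n%n≡0)
open import Data.Nat.ListAction using (sum)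
open import Data.Nat.Properties hiding (_≟_)
open import Algebra.Properties.CommutativeMonoid.Sum +-0-commutativeMonoid
  using (∑-distrib-+; sum-syntax; sum-cong-≗; sum-replicate-zero)
open import Data.Nat.Tactic.RingSolver using (solve-∀)
open import Data.Product using (Σ; ∃; ∃₂; _×_; _,_; proj₁; proj₂)
open import Data.Sum using (_⊎_; inj₁; inj₂; [_,_]′)
import Data.Sum as Sum
open import Function using (_∘_)
open import Level using (0ℓ)
open import Relation.Binary.Bundles using (DecTotalOrder)
import Relation.Binary.Construct.On as On
open import Relation.Binary.Definitions using (tri<; tri≈; tri>)
open import Relation.Binary.PropositionalEquality
  using (_≡_; _≢_; refl; sym; trans; cong; cong₂; subst; module ≡-Reasoning)
open import Relation.Nullary using (Dec; yes; no; does; ¬?)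
open import Relation.Nullary.Decidable using (_×-dec_; _⊎-dec_; dec-true; dec-false)

δ : ∀ {n} → Fin n → ℕ → Fin n → ℕ
δ a c w = if does (w ≟ a) then c else 0

sum-map-allFin : ∀ {n} (f : Fin n → ℕ) → sum (map f (allFin n)) ≡ ∑[ i < n ] f i
sum-map-allFin f = trans (cong sum (map-tabulate (λ i → i) f)) (sum-tabulate f)
  where
  sum-tabulate : ∀ {n} (f : Fin n → ℕ) → sum (tabulate f) ≡ ∑[ i < n ] f i
  sum-tabulate {zero} f = refl
  sum-tabulate {suc n} f = cong (f zero +_) (sum-tabulate (λ i → f (suc i)))

∑-δ : ∀ {n} (a : Fin n) c → ∑[ w < n ] δ a c w ≡ c
∑-δ {suc n} zero c = trans (cong (c +_) (sum-replicate-zero n)) (+-identityʳ c)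
∑-δ {suc n} (suc a) c = ∑-δ a c

∑-zero : ∀ {n} {f : Fin n → ℕ} → (∀ w → f w ≡ 0) → ∑[ w < n ] f w ≡ 0
∑-zero {n} f≡0 = trans (sum-cong-≗ f≡0) (sum-replicate-zero n)

∑-one : ∀ n → ∑[ w < n ] 1 ≡ n
∑-one zero = refl
∑-one (suc n) = cong suc (∑-one n)

∑-mono-≤ : ∀ {n} {f g : Fin n → ℕ} → (∀ w → f w ≤ g w) → ∑[ w < n ] f w ≤ ∑[ w < n ] g w
∑-mono-≤ {zero} f≤g = z≤n
∑-mono-≤ {suc n} f≤g = +-mono-≤ (f≤g zero) (∑-mono-≤ (λ w → f≤g (suc w)))

module _ {n : ℕ} where
  open import Data.List.Membership.DecPropositional (_≟_ {n}) using (_∈?_)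

  ∑-if-∈ : ∀ {xs} → Unique xs → (c : Fin n → ℕ)
         → ∑[ w < n ] (if does (w ∈? xs) then c w else 0) ≡ sum (map c xs)
  ∑-if-∈ {[]} [] c = ∑-zero {n} (λ _ → refl)
  ∑-if-∈ {x ∷ xs} (x∉xs ∷ unique) c = begin
    ∑[ w < n ] (if does (w ∈? x ∷ xs) then c w else 0)             ≡⟨ sum-cong-≗ split ⟩
    ∑[ w < n ] (δ x (c x) w + (if does (w ∈? xs) then c w else 0))  ≡⟨ ∑-distrib-+ (δ x (c x)) _ ⟩
    ∑[ w < n ] δ x (c x) w + ∑[ w < n ] (if does (w ∈? xs) then c w else 0)
                                                                     ≡⟨ cong₂ _+_ (∑-δ x (c x)) (∑-if-∈ unique c) ⟩
    c x + sum (map c xs)                                             ∎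
    where
    open ≡-Reasoning
    split : ∀ w → (if does (w ∈? x ∷ xs) then c w else 0)
                ≡ δ x (c x) w + (if does (w ∈? xs) then c w else 0)
    split w with w ≟ x
    ... | yes refl with w ∈? xs
    ...   | yes w∈xs = ⊥-elim (All.lookup x∉xs w∈xs refl)
    ...   | no _ = sym (+-identityʳ (c w))
    split w | no _ = refl

sum-map-const : ∀ {a} {A : Set a} {f : A → ℕ} {c} xs → All (λ x → f x ≡ c) xs
              → sum (map f xs) ≡ c * length xs
sum-map-const {c = c} [] [] = sym (*-zeroʳ c)
sum-map-const {c = c} (x ∷ xs) (fx≡c ∷ fxs≡c) =
  trans (cong₂ _+_ fx≡c (sum-map-const xs fxs≡c)) (sym (*-suc c (length xs)))

module _ {a ℓ} {A : Set a} {R : A → A → Set ℓ} where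

  AllPairs-++⁻ : ∀ xs {ys} → AllPairs R (xs ++ ys)
               → AllPairs R xs × All (λ x → All (R x) ys) xs × AllPairs R ys
  AllPairs-++⁻ [] rys = [] , [] , rys
  AllPairs-++⁻ (x ∷ xs) (rx ∷ rxys) with AllPairs-++⁻ xs rxys
  ... | rxs , cross , rys = All.++⁻ˡ xs rx ∷ rxs , All.++⁻ʳ xs rx ∷ cross , rys

suffix-of-length : ∀ {a} {A : Set a} (xs : List A) k → k ≤ length xs
                 → ∃₂ λ ys zs → xs ≡ ys ++ zs × length zs ≡ k
suffix-of-length xs k k≤∣xs∣ =
  take m xs , drop m xs , sym (take++drop≡id m xs) , trans (length-drop m xs) (m∸[m∸n]≡n k≤∣xs∣)
  where
  m : ℕ
  m = length xs ∸ k

distinct-members : ∀ {a} {A : Set a} {x y : A} {xs} → x ∈ xs → y ∈ xs → x ≢ y → 2 ≤ length xs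
distinct-members {xs = _ ∷ []} (here refl) (here refl) x≢y = ⊥-elim (x≢y refl)
distinct-members {xs = _ ∷ _ ∷ _} _ _ _ = s≤s (s≤s z≤n)

m+2*[1+n]≡m+2*n+2 : ∀ m n → m + 2 * suc n ≡ m + 2 * n + 2
m+2*[1+n]≡m+2*n+2 = solve-∀

m+2*[1+n]≡m+2+2*n : ∀ m n → m + 2 * suc n ≡ m + 2 + 2 * n
m+2*[1+n]≡m+2+2*n = solve-∀

m+2*[1+n+1+o]≡m+2*o+2+2*n+2 : ∀ m n o → m + 2 * (suc n + suc o) ≡ m + 2 * o + 2 + 2 * n + 2
m+2*[1+n+1+o]≡m+2*o+2+2*n+2 = solve-∀

m+[m+2]≡[m+1]*2 : ∀ m → m + (m + 2) ≡ (m + 1) * 2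
m+[m+2]≡[m+1]*2 = solve-∀

≤⇒≢+2 : ∀ {m n} → m ≤ n → m ≢ n + 2
≤⇒≢+2 {n = n} m≤n = <⇒≢ (≤-<-trans m≤n (m<m+n n z<s))

module SortedByKey {A : Set} (key : A → ℕ) where

  Sorted : List A → Set
  Sorted = AllPairs (λ x y → key x ≤ key y)

  sorted-around : ∀ pre {w post} → Sorted (pre ++ w ∷ post)
                → All (λ p → key p ≤ key w) pre × All (λ q → key w ≤ key q) post
                × Sorted pre × Sorted post
  sorted-around pre sorted with AllPairs-++⁻ pre sorted
  ... | sorted-pre , cross , w≤post ∷ sorted-post = All.map All.head cross , w≤post , sorted-pre , sorted-post

  free-offset : ∀ {l} → Sorted l → ∀ Y → ∃ λ i → i ≤ length l × All (λ x → key x ≢ Y + 2 * i) l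
  free-offset [] Y = 0 , z≤n , []
  free-offset {x ∷ l} (x≤l ∷ sorted) Y with <-cmp (key x) Y
  ... | tri< x<Y _ _ with free-offset sorted Y
  ...   | i , i≤∣l∣ , l≢ = i , m≤n⇒m≤1+n i≤∣l∣ , <⇒≢ (<-≤-trans x<Y (m≤m+n Y (2 * i))) ∷ l≢
  free-offset {x ∷ l} (x≤l ∷ sorted) Y | tri> _ _ Y<x =
    0 , z≤n , All.map (λ {y} x≤y → >⇒≢ (subst (_< key y) (sym (+-identityʳ Y)) (<-≤-trans Y<x x≤y))) (≤-refl ∷ x≤l)
  free-offset {x ∷ l} (x≤l ∷ sorted) Y | tri≈ _ x≡Y _ with free-offset sorted (Y + 2)
  ... | i , i≤∣l∣ , l≢ =
    suc i , s≤s i≤∣l∣ , (λ e → m+1+n≢m Y (sym (trans (sym x≡Y) e)))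
                      ∷ All.map (λ ≢ e → ≢ (trans e (m+2*[1+n]≡m+2+2*n Y i))) l≢

  threshold : ∀ X {L} → Sorted L → ∃₂ λ P Q → L ≡ P ++ Q
            × All (λ p → key p < X + 2 * length Q) P × All (λ q → X + 2 * length Q ≤ key q + 2) Q
  threshold X [] = [] , [] , refl , [] , []
  threshold X {x ∷ L} (x≤L ∷ sorted) with threshold X sorted
  ... | p ∷ P , Q , refl , p<Y ∷ P<Y , Y≤Q =
    x ∷ p ∷ P , Q , refl , ≤-<-trans (All.head x≤L) p<Y ∷ p<Y ∷ P<Y , Y≤Q
  ... | [] , Q , refl , [] , Y≤Q with key x <? X + 2 * length Q
  ...   | yes x<Y = [ x ] , Q , refl , x<Y ∷ [] , Y≤Q
  ...   | no x≮Y = [] , x ∷ Q , refl , [] , All.map Y′≤ (≤-refl ∷ x≤L)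
    where
    Y′≤ : ∀ {y} → key x ≤ key y → X + 2 * suc (length Q) ≤ key y + 2
    Y′≤ {y} x≤y = subst (_≤ key y + 2) (sym (m+2*[1+n]≡m+2*n+2 X (length Q)))
                        (+-monoˡ-≤ 2 (≤-trans (≮⇒≥ x≮Y) x≤y))

  halves⇒nonempty : ∀ pre {w : A} post → length pre ≡ length post → 2 ≤ length (pre ++ w ∷ post)
                  → ∃₂ λ q post′ → post ≡ q ∷ post′
  halves⇒nonempty [] [] _ (s≤s ())
  halves⇒nonempty (_ ∷ _) [] () _
  halves⇒nonempty pre (q ∷ post′) _ _ = q , post′ , refl

  module _ (X : ℕ) where

    -- X is the colour g(v₀); raising the keys in Q by 2 makes X + 2|Q| the new colour of v₀.
    Balanced : List A → List A → Set
    Balanced P Q = All (λ p → key p ≢ X + 2 * length Q) P × All (λ q → key q + 2 ≢ X + 2 * length Q) Q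

    data Choice (L : List A) : Set where
      balanced : ∀ P Q → L ≡ P ++ Q → Balanced P Q → Choice L
      pivot    : ∀ pre w w′ post → L ≡ pre ++ w ∷ w′ ∷ post → key w ≡ X + 2 * suc (length post)
               → All (λ p → key p < key w) pre → key w < key w′ → Choice L

    module Tight (pre : List A) (w : A) (post : List A) (sorted : Sorted (pre ++ w ∷ post))
                 (tight : key w ≡ X + 2 * length post) where

      pre≤w : All (λ p → key p ≤ key w) pre
      pre≤w = proj₁ (sorted-around pre sorted)

      w≤post : All (λ q → key w ≤ key q) post
      w≤post = proj₁ (proj₂ (sorted-around pre sorted))

      sorted-pre : Sorted pre
      sorted-pre = proj₁ (proj₂ (proj₂ (sorted-around pre sorted)))

      sorted-post : Sorted post
      sorted-post = proj₂ (proj₂ (proj₂ (sorted-around pre sorted)))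

      balanced-below : ∀ i → i < length post → All (λ p → key p ≢ X + 2 * i) pre
                     → Choice (pre ++ w ∷ post)
      balanced-below i i<∣post∣ pre≢ with suffix-of-length post i (<⇒≤ i<∣post∣)
      ... | Q₁ , Q₂ , post≡ , refl =
        balanced (pre ++ w ∷ Q₁) Q₂ L≡
          ( All.++⁺ pre≢ (All.map (λ w≤q → >⇒≢ (<-≤-trans Y<w w≤q)) (≤-refl ∷ All.++⁻ˡ Q₁ w≤Q))
          , All.map (λ w≤q → >⇒≢ (<-≤-trans Y<w (≤-trans w≤q (m≤m+n _ 2)))) (All.++⁻ʳ Q₁ w≤Q) )
        where
        L≡ : pre ++ w ∷ post ≡ (pre ++ w ∷ Q₁) ++ Q₂
        L≡ = trans (cong (λ z → pre ++ w ∷ z) post≡) (sym (++-assoc pre (w ∷ Q₁) Q₂))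
        w≤Q : All (λ q → key w ≤ key q) (Q₁ ++ Q₂)
        w≤Q = subst (All _) post≡ w≤post
        Y<w : X + 2 * length Q₂ < key w
        Y<w = subst (X + 2 * length Q₂ <_) (sym tight) (+-monoʳ-< X (*-monoʳ-< 2 i<∣post∣))

      balanced-above : ∀ i → i < length pre → All (λ q → key q ≢ key w + 2 + 2 * i) post
                     → Choice (pre ++ w ∷ post)
      balanced-above i i<∣pre∣ post≢ with suffix-of-length pre (suc i) i<∣pre∣
      ... | P₁ , P₂ , pre≡ , ∣P₂∣≡1+i =
        balanced P₁ (P₂ ++ w ∷ post) L≡
          ( All.map (λ p≤w → <⇒≢ (≤-<-trans (m≤m+n _ 2) (below p≤w))) (All.++⁻ˡ P₁ pre≤w′)
          , All.++⁺ (All.map (λ p≤w → <⇒≢ (below p≤w)) (All.++⁻ʳ P₁ pre≤w′))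
                    (<⇒≢ (below ≤-refl) ∷ All.map (λ q≢ e → q≢ (+-cancelʳ-≡ 2 _ _ (trans e Y≡))) post≢) )
        where
        L≡ : pre ++ w ∷ post ≡ P₁ ++ (P₂ ++ w ∷ post)
        L≡ = trans (cong (_++ w ∷ post) pre≡) (++-assoc P₁ P₂ (w ∷ post))
        pre≤w′ : All (λ p → key p ≤ key w) (P₁ ++ P₂)
        pre≤w′ = subst (All _) pre≡ pre≤w
        Y≡ : X + 2 * length (P₂ ++ w ∷ post) ≡ key w + 2 + 2 * i + 2
        Y≡ = begin
          X + 2 * length (P₂ ++ w ∷ post)          ≡⟨ cong (λ l → X + 2 * l) (length-++ P₂) ⟩
          X + 2 * (length P₂ + suc (length post))  ≡⟨ cong (λ l → X + 2 * (l + suc (length post))) ∣P₂∣≡1+i ⟩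
          X + 2 * (suc i + suc (length post))      ≡⟨ m+2*[1+n+1+o]≡m+2*o+2+2*n+2 X i (length post) ⟩
          X + 2 * length post + 2 + 2 * i + 2      ≡⟨ cong (λ k → k + 2 + 2 * i + 2) tight ⟨
          key w + 2 + 2 * i + 2                    ∎
          where open ≡-Reasoning
        below : ∀ {v} → key v ≤ key w → key v + 2 < X + 2 * length (P₂ ++ w ∷ post)
        below {v} v≤w = subst (key v + 2 <_) (sym Y≡)
          (≤-<-trans (≤-trans (+-monoˡ-≤ 2 v≤w) (m≤m+n _ (2 * i))) (m<m+n _ z<s))

      -- Pigeonhole: if |pre| < |post|, the keys of pre cannot occupy all |post| slots X + 2i < key w,
      -- and symmetrically for post and the slots key w + 2 + 2i.  If |pre| = |post|, a key equal to
      -- key w on either side of w frees a slot; otherwise w is a pivot.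
      choice : 2 ≤ length (pre ++ w ∷ post) → Choice (pre ++ w ∷ post)
      choice 2≤∣L∣ with <-cmp (length pre) (length post)
      ... | tri< c<d _ _ with free-offset sorted-pre X
      ...   | i , i≤c , pre≢ = balanced-below i (≤-<-trans i≤c c<d) pre≢
      choice 2≤∣L∣ | tri> _ _ d<c with free-offset sorted-post (key w + 2)
      ...   | j , j≤d , post≢ = balanced-above j (≤-<-trans j≤d d<c) post≢
      choice 2≤∣L∣ | tri≈ _ c≡d _ with free-offset sorted-pre X
      ...   | i , i≤c , pre≢ with m≤n⇒m<n∨m≡n i≤c
      ...     | inj₁ i<c = balanced-below i (subst (i <_) c≡d i<c) pre≢
      ...     | inj₂ refl with free-offset sorted-post (key w)
      ...       | suc j , j<d , post≢ =
        balanced-above j (subst (j <_) (sym c≡d) j<d)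
                       (All.map (λ q≢ e → q≢ (trans e (sym (m+2*[1+n]≡m+2+2*n (key w) j)))) post≢)
      ...       | zero , _ , post≢ with halves⇒nonempty pre post c≡d 2≤∣L∣
      ...         | q , post′ , refl = pivot pre w q post′ refl tight pre<w w<q
        where
        pre≢w : All (λ p → key p ≢ key w) pre
        pre≢w = All.map (λ p≢ e → p≢ (trans e (trans tight (cong (λ l → X + 2 * l) (sym c≡d))))) pre≢
        pre<w : All (λ p → key p < key w) pre
        pre<w = All.zipWith (λ (p≤w , p≢w) → ≤∧≢⇒< p≤w p≢w) (pre≤w , pre≢w)
        w<q : key w < key q
        w<q = ≤∧≢⇒< (All.head w≤post) (λ e → All.head post≢ (trans (sym e) (sym (+-identityʳ (key w)))))

    choose : ∀ {L} → Sorted L → 2 ≤ length L → Choice L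
    choose sorted 2≤∣L∣ with threshold X sorted
    ... | P , [] , refl , P<Y , [] = balanced P [] refl (All.map <⇒≢ P<Y , [])
    ... | P , w ∷ post , refl , P<Y , Y≤w+2 ∷ _ with key w ℕ.≟ X + 2 * length post
    ...   | yes tight = Tight.choice P w post sorted tight 2≤∣L∣
    ...   | no loose = balanced P (w ∷ post) refl
                         ( All.map <⇒≢ P<Y
                         , All.map (λ w≤q → >⇒≢ (<-≤-trans Y<w+2 (+-monoˡ-≤ 2 w≤q))) (≤-refl ∷ w≤post) )
      where
      w≤post : All (λ q → key w ≤ key q) post
      w≤post = proj₁ (proj₂ (sorted-around P sorted))
      Y≤w : X + 2 * length post ≤ key w
      Y≤w = +-cancelʳ-≤ 2 _ _ (subst (_≤ key w + 2) (m+2*[1+n]≡m+2*n+2 X (length post)) Y≤w+2)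
      Y<w+2 : X + 2 * suc (length post) < key w + 2
      Y<w+2 = subst (_< key w + 2) (sym (m+2*[1+n]≡m+2*n+2 X (length post)))
                (+-monoˡ-< 2 (≤∧≢⇒< Y≤w (loose ∘ sym)))

module _ {n : ℕ} (G : Graph n) (v₀ : Fin n) where

  open import Data.List.Membership.DecPropositional (_≟_ {n}) using (_∈?_)

  Universal : Set
  Universal = ∀ w → w ≢ v₀ → adj G v₀ w ≡ true

  full-degree⇒universal : deg G v₀ ≡ n ∸ 1 → Universal
  full-degree⇒universal deg≡ w w≢v₀ with adj G v₀ w in adj≡
  ... | true = refl
  ... | false = ⊥-elim (no-room v₀ (subst (λ d → d + 1 + 1 ≤ n) deg≡ deg+2≤n))
    where
    indicator : Fin n → ℕ
    indicator u = if adj G v₀ u then 1 else 0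
    at-most-one : ∀ u → indicator u + δ v₀ 1 u + δ w 1 u ≤ 1
    at-most-one u with u ≟ v₀ | u ≟ w
    ... | yes refl | yes refl = ⊥-elim (w≢v₀ refl)
    ... | yes refl | no _ rewrite adj-irrefl G v₀ = ≤-refl
    ... | no _ | yes refl rewrite adj≡ = ≤-refl
    ... | no _ | no _ with adj G v₀ u
    ...   | true = ≤-refl
    ...   | false = z≤n
    deg+2≤n : deg G v₀ + 1 + 1 ≤ n
    deg+2≤n = begin
      deg G v₀ + 1 + 1
        ≡⟨ cong₂ (λ d b → d + b + 1) (sum-map-allFin indicator) (sym (∑-δ v₀ 1)) ⟩
      ∑[ u < n ] indicator u + ∑[ u < n ] δ v₀ 1 u + 1
        ≡⟨ cong₂ _+_ (∑-distrib-+ indicator (δ v₀ 1)) (∑-δ w 1) ⟨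
      ∑[ u < n ] (indicator u + δ v₀ 1 u) + ∑[ u < n ] δ w 1 u
        ≡⟨ ∑-distrib-+ (λ u → indicator u + δ v₀ 1 u) (δ w 1) ⟨
      ∑[ u < n ] (indicator u + δ v₀ 1 u + δ w 1 u)
        ≤⟨ ∑-mono-≤ at-most-one ⟩
      ∑[ u < n ] 1
        ≡⟨ ∑-one n ⟩
      n ∎
      where open ≤-Reasoning
    no-room : ∀ {m} → Fin m → m ∸ 1 + 1 + 1 ≤ m → ⊥
    no-room {suc m} _ m+1+1≤1+m = 1+n≰n (subst (_≤ suc m) (trans (+-assoc m 1 1) (+-comm m 2)) m+1+1≤1+m)

  adj⇒≢ : ∀ {u v} → adj G u v ≡ true → u ≢ v
  adj⇒≢ {u} adj-uv refl with () ← trans (sym adj-uv) (adj-irrefl G u)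

  module Weighted (spoke : Fin n → Fin 3) (inner : Fin n → Fin n → Fin 3) where

    weighting : Fin n → Fin n → Fin 3
    weighting u v = if does (u ≟ v₀) then spoke v else if does (v ≟ v₀) then spoke u else inner u v

    weighting-centreˡ : ∀ v → weighting v₀ v ≡ spoke v
    weighting-centreˡ v with v₀ ≟ v₀
    ... | yes _ = refl
    ... | no v₀≢v₀ = ⊥-elim (v₀≢v₀ refl)

    weighting-inner : ∀ u v → u ≢ v₀ → v ≢ v₀ → weighting u v ≡ inner u v
    weighting-inner u v u≢v₀ v≢v₀ with u ≟ v₀ | v ≟ v₀
    ... | yes u≡v₀ | _ = ⊥-elim (u≢v₀ u≡v₀)
    ... | no _ | yes v≡v₀ = ⊥-elim (v≢v₀ v≡v₀)
    ... | no _ | no _ = refl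

    weighting-sym : (∀ u v → inner u v ≡ inner v u) → ∀ u v → weighting u v ≡ weighting v u
    weighting-sym inner-sym u v with u ≟ v₀ | v ≟ v₀
    ... | yes refl | yes refl = refl
    ... | yes refl | no _ = refl
    ... | no _ | yes refl = refl
    ... | no _ | no _ = inner-sym u v

    sh-weighting : Universal → ∀ v → v ≢ v₀ → inner v v₀ ≡ 0F
                 → sh G weighting v ≡ toℕ (spoke v) + sh G inner v
    sh-weighting univ v v≢v₀ inner≡0 = begin
      sh G weighting v
        ≡⟨ sum-map-allFin {n} _ ⟩
      ∑[ w < n ] (if adj G v w then toℕ (weighting v w) else 0)
        ≡⟨ sum-cong-≗ split ⟩
      ∑[ w < n ] (δ v₀ (toℕ (spoke v)) w + inner-term w)
        ≡⟨ ∑-distrib-+ (δ v₀ (toℕ (spoke v))) inner-term ⟩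
      ∑[ w < n ] δ v₀ (toℕ (spoke v)) w + ∑[ w < n ] inner-term w
        ≡⟨ cong₂ _+_ (∑-δ v₀ _) (sym (sum-map-allFin inner-term)) ⟩
      toℕ (spoke v) + sh G inner v
        ∎
      where
      open ≡-Reasoning
      inner-term : Fin n → ℕ
      inner-term w = if adj G v w then toℕ (inner v w) else 0
      split : ∀ w → (if adj G v w then toℕ (weighting v w) else 0) ≡ δ v₀ (toℕ (spoke v)) w + inner-term w
      split w with w ≟ v₀ | v ≟ v₀
      ... | _ | yes v≡v₀ = ⊥-elim (v≢v₀ v≡v₀)
      ... | yes refl | no _ rewrite adj-sym G v v₀ | univ v v≢v₀ | inner≡0 = sym (+-identityʳ _)
      ... | no _ | no _ = refl

  -- An endpoint of an inner edge of weight 1 gets a spoke of weight 1, so s = 2 on all of In.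
  spokes : List (Fin n) → (Fin n → Bool) → Fin n → Fin 3
  spokes In endpoint w = if does (w ∈? In) then (if endpoint w then 1F else 2F) else 0F

  lift : List (Fin n) → Fin n → ℕ
  lift In v = if does (v ∈? In) then 2 else 0

  lift-0-or-2 : ∀ In v → lift In v ≡ 0 ⊎ lift In v ≡ 2
  lift-0-or-2 In v with v ∈? In
  ... | yes _ = inj₂ refl
  ... | no _ = inj₁ refl

  module Spoked (univ : Universal) (In : List (Fin n)) (endpoint : Fin n → Bool)
                (inner : Fin n → Fin n → Fin 3) where
    open Weighted (spokes In endpoint) inner

    sh-spokes-centre : Unique In → All (_≢ v₀) In
                     → sh G weighting v₀ ≡ sum (map (λ w → toℕ (if endpoint w then 1F else 2F)) In)
    sh-spokes-centre unique In≢v₀ =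
      trans (sum-map-allFin {n} _) (trans (sum-cong-≗ spoke-term) (∑-if-∈ unique _))
      where
      spoke-term : ∀ w → (if adj G v₀ w then toℕ (weighting v₀ w) else 0)
                       ≡ (if does (w ∈? In) then toℕ (if endpoint w then 1F else 2F) else 0)
      spoke-term w rewrite weighting-centreˡ w with w ∈? In
      ... | yes w∈In rewrite univ w (All.lookup In≢v₀ w∈In) = refl
      ... | no _ = if-eta (adj G v₀ w)

    sh-spokes-lift : ∀ v → v ≢ v₀ → inner v v₀ ≡ 0F → sh G inner v ≡ (if endpoint v then 1 else 0)
                   → (endpoint v ≡ true → v ∈ In) → sh G weighting v ≡ lift In v
    sh-spokes-lift v v≢v₀ inner≡0 inner-degree endpoint⇒In =
      trans (sh-weighting univ v v≢v₀ inner≡0) (trans (cong (toℕ (spokes In endpoint v) +_) inner-degree) by-cases)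
      where
      by-cases : toℕ (spokes In endpoint v) + (if endpoint v then 1 else 0) ≡ lift In v
      by-cases with v ∈? In | endpoint v
      ... | yes _ | true = refl
      ... | yes _ | false = refl
      ... | no v∉In | true = ⊥-elim (v∉In (endpoint⇒In refl))
      ... | no _ | false = refl

  module _ (g : Fin n → ℕ) where

    record InnerWeighting : Set where
      field
        weight        : Fin n → Fin n → Fin 3
        endpoint      : Fin n → Bool
        weight-sym    : ∀ u v → weight u v ≡ weight v u
        weight-centre : ∀ v → weight v v₀ ≡ 0F
        weight-≤1     : ∀ u v → toℕ (weight u v) ≤ 1
        weight-odd    : ∀ u v → (g u + g v) % 2 ≡ 1 → weight u v ≡ 0F
        degree        : ∀ v → v ≢ v₀ → sh G weight v ≡ (if endpoint v then 1 else 0)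

    noInner : InnerWeighting
    noInner = record
      { weight        = λ _ _ → 0F
      ; endpoint      = λ _ → false
      ; weight-sym    = λ _ _ → refl
      ; weight-centre = λ _ → refl
      ; weight-≤1     = λ _ _ → z≤n
      ; weight-odd    = λ _ _ _ → refl
      ; degree        = λ v _ → trans (sum-map-allFin {n} _) (∑-zero (λ w → if-eta (adj G v w)))
      }

    module _ (p q : Fin n) where

      Pair : Fin n → Fin n → Set
      Pair u v = (u ≡ p × v ≡ q) ⊎ (u ≡ q × v ≡ p)

      pair? : ∀ u v → Dec (Pair u v)
      pair? u v = (u ≟ p ×-dec v ≟ q) ⊎-dec (u ≟ q ×-dec v ≟ p)

      pair-swap : ∀ {u v} → Pair u v → Pair v u
      pair-swap (inj₁ (u≡p , v≡q)) = inj₂ (v≡q , u≡p)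
      pair-swap (inj₂ (u≡q , v≡p)) = inj₁ (v≡p , u≡q)

      pair-unique : p ≢ q → ∀ {x y z} → Pair x y → Pair x z → y ≡ z
      pair-unique _ (inj₁ (_ , refl)) (inj₁ (_ , refl)) = refl
      pair-unique _ (inj₂ (_ , refl)) (inj₂ (_ , refl)) = refl
      pair-unique p≢q (inj₁ (refl , _)) (inj₂ (x≡q , _)) = ⊥-elim (p≢q x≡q)
      pair-unique p≢q (inj₂ (refl , _)) (inj₁ (x≡p , _)) = ⊥-elim (p≢q (sym x≡p))

      pairInner : p ≢ q → adj G p q ≡ true → (g p + g q) % 2 ≡ 0 → p ≢ v₀ → q ≢ v₀ → InnerWeighting
      pairInner p≢q adj-pq even p≢v₀ q≢v₀ = record
        { weight        = weight
        ; endpoint      = λ v → does (v ≟ p ⊎-dec v ≟ q)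
        ; weight-sym    = weight-sym
        ; weight-centre = weight-centre
        ; weight-≤1     = weight-≤1
        ; weight-odd    = weight-odd
        ; degree        = degree
        }
        where
        weight : Fin n → Fin n → Fin 3
        weight u v with pair? u v
        ... | yes _ = 1F
        ... | no _ = 0F

        weight-sym : ∀ u v → weight u v ≡ weight v u
        weight-sym u v with pair? u v | pair? v u
        ... | yes _ | yes _ = refl
        ... | no _ | no _ = refl
        ... | yes puv | no ¬pvu = ⊥-elim (¬pvu (pair-swap puv))
        ... | no ¬puv | yes pvu = ⊥-elim (¬puv (pair-swap pvu))

        weight-centre : ∀ v → weight v v₀ ≡ 0F
        weight-centre v with pair? v v₀
        ... | yes (inj₁ (_ , v₀≡q)) = ⊥-elim (q≢v₀ (sym v₀≡q))
        ... | yes (inj₂ (_ , v₀≡p)) = ⊥-elim (p≢v₀ (sym v₀≡p))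
        ... | no _ = refl

        weight-≤1 : ∀ u v → toℕ (weight u v) ≤ 1
        weight-≤1 u v with pair? u v
        ... | yes _ = s≤s z≤n
        ... | no _ = z≤n

        weight-odd : ∀ u v → (g u + g v) % 2 ≡ 1 → weight u v ≡ 0F
        weight-odd u v odd with pair? u v
        ... | yes (inj₁ (refl , refl)) = ⊥-elim (0≢1+n (trans (sym even) odd))
        ... | yes (inj₂ (refl , refl)) =
          ⊥-elim (0≢1+n (trans (sym even) (trans (cong (_% 2) (+-comm (g p) (g q))) odd)))
        ... | no _ = refl

        adj-pair : ∀ {x y} → Pair x y → adj G x y ≡ true
        adj-pair (inj₁ (refl , refl)) = adj-pq
        adj-pair (inj₂ (refl , refl)) = trans (adj-sym G q p) adj-pq

        degree-endpoint : ∀ {x y} → Pair x y → sh G weight x ≡ 1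
        degree-endpoint {x} {y} pxy = trans (sum-map-allFin {n} _) (trans (sum-cong-≗ partner) (∑-δ y 1))
          where
          partner : ∀ w → (if adj G x w then toℕ (weight x w) else 0) ≡ δ y 1 w
          partner w with pair? x w | w ≟ y
          ... | yes _ | yes refl rewrite adj-pair pxy = refl
          ... | yes pxw | no w≢y = ⊥-elim (w≢y (pair-unique p≢q pxw pxy))
          ... | no ¬pxw | yes refl = ⊥-elim (¬pxw pxy)
          ... | no _ | no _ = if-eta (adj G x w)

        degree-other : ∀ {x} → x ≢ p → x ≢ q → sh G weight x ≡ 0
        degree-other {x} x≢p x≢q = trans (sum-map-allFin {n} _) (∑-zero none)
          where
          none : ∀ w → (if adj G x w then toℕ (weight x w) else 0) ≡ 0
          none w with pair? x w
          ... | yes (inj₁ (x≡p , _)) = ⊥-elim (x≢p x≡p)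
          ... | yes (inj₂ (x≡q , _)) = ⊥-elim (x≢q x≡q)
          ... | no _ = if-eta (adj G x w)

        degree : ∀ v → v ≢ v₀ → sh G weight v ≡ (if does (v ≟ p ⊎-dec v ≟ q) then 1 else 0)
        degree v _ = by-cases v (v ≟ p) (v ≟ q)
          where
          by-cases : ∀ v (v≟p : Dec (v ≡ p)) (v≟q : Dec (v ≡ q))
                   → sh G weight v ≡ (if does (v≟p ⊎-dec v≟q) then 1 else 0)
          by-cases v (yes refl) _ = degree-endpoint (inj₁ (refl , refl))
          by-cases v (no _) (yes refl) = degree-endpoint (inj₂ (refl , refl))
          by-cases v (no v≢p) (no v≢q) = degree-other v≢p v≢q

    Admissible : (Fin n → Fin n → Fin 3) → Set
    Admissible h =
        (∀ u v → adj G u v ≡ true → h u v ≡ h v u)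
      × (∀ u v → adj G u v ≡ true → u ≢ v₀ → v ≢ v₀ → (g u + g v) % 2 ≡ 0 → toℕ (h u v) ≤ 1)
      × (∀ u v → adj G u v ≡ true → u ≢ v₀ → v ≢ v₀ → (g u + g v) % 2 ≡ 1 → h u v ≡ zero)
      × (∀ v → adj G v₀ v ≡ true → (sh G h v ≡ 0 ⊎ sh G h v ≡ 2))
      × (∀ u v → adj G u v ≡ true → g u + sh G h u ≢ g v + sh G h v)

    ProperOffCentre : Set
    ProperOffCentre = ∀ u v → adj G u v ≡ true → u ≢ v₀ → v ≢ v₀ → g u ≢ g v

    -- g + s is proper when s is 2 on In, 0 on the rest of N(v₀) and T at v₀.
    record ProperLift (In : List (Fin n)) (T : ℕ) : Set where
      field
        cut        : ∀ {u v} → adj G u v ≡ true → v ≢ v₀ → u ∈ In → v ∉ In → g v ≢ g u + 2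
        centre-in  : ∀ {v} → v ∈ In → g v + 2 ≢ g v₀ + T
        centre-out : ∀ {v} → v ≢ v₀ → v ∉ In → g v ≢ g v₀ + T

    module _ (proper : ProperOffCentre) {In : List (Fin n)} {T : ℕ} (lift-ok : ProperLift In T) where
      open ProperLift lift-ok

      lift-proper : ∀ u v → adj G u v ≡ true → u ≢ v₀ → v ≢ v₀ → g u + lift In u ≢ g v + lift In v
      lift-proper u v adj-uv u≢v₀ v≢v₀ with u ∈? In | v ∈? In
      ... | yes _ | yes _ = λ e → proper u v adj-uv u≢v₀ v≢v₀ (+-cancelʳ-≡ 2 _ _ e)
      ... | no _ | no _ = λ e → proper u v adj-uv u≢v₀ v≢v₀ (+-cancelʳ-≡ 0 _ _ e)
      ... | yes u∈In | no v∉In = λ e → cut adj-uv v≢v₀ u∈In v∉In (trans (sym (+-identityʳ _)) (sym e))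
      ... | no u∉In | yes v∈In =
        λ e → cut (trans (adj-sym G v u) adj-uv) u≢v₀ v∈In u∉In (trans (sym (+-identityʳ _)) e)

      lift-centre : ∀ v → v ≢ v₀ → g v + lift In v ≢ g v₀ + T
      lift-centre v v≢v₀ with v ∈? In
      ... | yes v∈In = centre-in v∈In
      ... | no v∉In = λ e → centre-out v≢v₀ v∉In (trans (sym (+-identityʳ _)) e)

      lift-colouring : (h : Fin n → Fin n → Fin 3) → (∀ v → v ≢ v₀ → sh G h v ≡ lift In v) → sh G h v₀ ≡ T
                     → ∀ u v → adj G u v ≡ true → g u + sh G h u ≢ g v + sh G h v
      lift-colouring h level centre u v adj-uv with u ≟ v₀ | v ≟ v₀
      ... | yes refl | yes refl = ⊥-elim (adj⇒≢ adj-uv refl)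
      ... | yes refl | no v≢v₀ rewrite centre | level v v≢v₀ = λ e → lift-centre v v≢v₀ (sym e)
      ... | no u≢v₀ | yes refl rewrite centre | level u u≢v₀ = lift-centre u u≢v₀
      ... | no u≢v₀ | no v≢v₀ rewrite level u u≢v₀ | level v v≢v₀ = lift-proper u v adj-uv u≢v₀ v≢v₀

    open SortedByKey g

    private
      byKey : DecTotalOrder 0ℓ 0ℓ 0ℓ
      byKey = On.decTotalOrder ≤-decTotalOrder g
    open import Data.List.Sort byKey using (sort; sort-↭; sort-↗)

    others : List (Fin n)
    others = sort (filter (λ w → ¬? (w ≟ v₀)) (allFin n))

    ∈-others⁺ : ∀ {w} → w ≢ v₀ → w ∈ others
    ∈-others⁺ {w} w≢v₀ = ∈-resp-↭ (↭-sym (sort-↭ _)) (∈-filter⁺ (λ w → ¬? (w ≟ v₀)) (∈-allFin w) w≢v₀)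

    ∈-others⁻ : ∀ {w} → w ∈ others → w ≢ v₀
    ∈-others⁻ w∈ = proj₂ (∈-filter⁻ (λ w → ¬? (w ≟ v₀)) {xs = allFin n} (∈-resp-↭ (sort-↭ _) w∈))

    others-unique : Unique others
    others-unique = PermutationProperties.Unique-resp-↭ (≡-setoid n) (↭⇒↭ₛ (↭-sym (sort-↭ _)))
                      (Unique.filter⁺ (λ w → ¬? (w ≟ v₀)) (Unique.allFin⁺ n))

    others-sorted : Sorted others
    others-sorted = SortedProperties.Sorted⇒AllPairs (DecTotalOrder.totalOrder byKey) (sort-↗ _)

    module _ (univ : Universal) (proper : ProperOffCentre) where

      admissible-spoked : (I : InnerWeighting) → ∀ In → Unique In → All (_≢ v₀) In
        → (∀ v → InnerWeighting.endpoint I v ≡ true → v ∈ In)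
        → ∀ T → sum (map (λ w → toℕ (if InnerWeighting.endpoint I w then 1F else 2F)) In) ≡ T
        → ProperLift In T → Σ (Fin n → Fin n → Fin 3) Admissible
      admissible-spoked I In unique In≢v₀ endpoint⇒In T T≡ lift-ok =
        h , (λ u v _ → weighting-sym weight-sym u v) , at-most-one , odd-zero , zero-or-two ,
        lift-colouring proper lift-ok h level centre
        where
        open InnerWeighting I
        open Weighted (spokes In endpoint) weight
        open Spoked univ In endpoint weight
        h : Fin n → Fin n → Fin 3
        h = weighting
        level : ∀ v → v ≢ v₀ → sh G h v ≡ lift In v
        level v v≢v₀ = sh-spokes-lift v v≢v₀ (weight-centre v) (degree v v≢v₀) (endpoint⇒In v)
        centre : sh G h v₀ ≡ T
        centre = trans (sh-spokes-centre unique In≢v₀) T≡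
        at-most-one : ∀ u v → adj G u v ≡ true → u ≢ v₀ → v ≢ v₀ → (g u + g v) % 2 ≡ 0 → toℕ (h u v) ≤ 1
        at-most-one u v _ u≢v₀ v≢v₀ _ =
          subst (λ x → toℕ x ≤ 1) (sym (weighting-inner u v u≢v₀ v≢v₀)) (weight-≤1 u v)
        odd-zero : ∀ u v → adj G u v ≡ true → u ≢ v₀ → v ≢ v₀ → (g u + g v) % 2 ≡ 1 → h u v ≡ zero
        odd-zero u v _ u≢v₀ v≢v₀ odd = trans (weighting-inner u v u≢v₀ v≢v₀) (weight-odd u v odd)
        zero-or-two : ∀ v → adj G v₀ v ≡ true → (sh G h v ≡ 0 ⊎ sh G h v ≡ 2)
        zero-or-two v adj-v₀v = Sum.map (trans level-v) (trans level-v) (lift-0-or-2 In v)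
          where
          level-v : sh G h v ≡ lift In v
          level-v = level v (λ v≡v₀ → adj⇒≢ adj-v₀v (sym v≡v₀))

      balanced⇒admissible : ∀ P Q → others ≡ P ++ Q → Balanced (g v₀) P Q → Σ (Fin n → Fin n → Fin 3) Admissible
      balanced⇒admissible P Q others≡ (P≢ , Q≢) =
        admissible-spoked noInner Q unique-Q Q≢v₀ (λ _ ()) (2 * length Q)
                  (sum-map-const Q (All.tabulate (λ _ → refl))) lift-ok
        where
        cross : All (λ p → All (λ q → g p ≤ g q) Q) P
        cross = proj₁ (proj₂ (AllPairs-++⁻ P (subst Sorted others≡ others-sorted)))
        unique-Q : Unique Q
        unique-Q = proj₂ (proj₂ (AllPairs-++⁻ P (subst Unique others≡ others-unique)))
        Q≢v₀ : All (_≢ v₀) Q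
        Q≢v₀ = All.tabulate (λ q∈Q → ∈-others⁻ (subst (_ ∈_) (sym others≡) (∈-++⁺ʳ P q∈Q)))
        in-P : ∀ {v} → v ≢ v₀ → v ∉ Q → v ∈ P
        in-P {v} v≢v₀ v∉Q with ∈-++⁻ P (subst (v ∈_) others≡ (∈-others⁺ v≢v₀))
        ... | inj₁ v∈P = v∈P
        ... | inj₂ v∈Q = ⊥-elim (v∉Q v∈Q)
        lift-ok : ProperLift Q (2 * length Q)
        lift-ok = record
          { cut        = λ _ v≢v₀ u∈Q v∉Q → ≤⇒≢+2 (All.lookup (All.lookup cross (in-P v≢v₀ v∉Q)) u∈Q)
          ; centre-in  = All.lookup Q≢
          ; centre-out = λ v≢v₀ v∉Q → All.lookup P≢ (in-P v≢v₀ v∉Q)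
          }

      module Pivot (pre : List (Fin n)) (w w′ : Fin n) (post : List (Fin n))
                   (others≡ : others ≡ pre ++ w ∷ w′ ∷ post) (tight : g w ≡ g v₀ + 2 * suc (length post))
                   (pre<w : All (λ p → g p < g w) pre) (w<w′ : g w < g w′) where

        T : ℕ
        T = 2 * suc (length post)

        sorted-top : Sorted (w ∷ w′ ∷ post)
        sorted-top = proj₂ (proj₂ (AllPairs-++⁻ pre (subst Sorted others≡ others-sorted)))

        unique-top : Unique (w ∷ w′ ∷ post)
        unique-top = proj₂ (proj₂ (AllPairs-++⁻ pre (subst Unique others≡ others-unique)))

        top≢v₀ : All (_≢ v₀) (w ∷ w′ ∷ post)
        top≢v₀ = All.tabulate (λ u∈top → ∈-others⁻ (subst (_ ∈_) (sym others≡) (∈-++⁺ʳ pre u∈top)))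

        w′≤post : All (λ q → g w′ ≤ g q) post
        w′≤post = AllPairs.head (AllPairs.tail sorted-top)

        w≤top : ∀ {u} → u ∈ w ∷ w′ ∷ post → g w ≤ g u
        w≤top (here refl) = ≤-refl
        w≤top (there u∈w′∷post) = All.lookup (AllPairs.head sorted-top) u∈w′∷post

        split : ∀ {v} → v ≢ v₀ → v ∈ pre ⊎ v ∈ w ∷ w′ ∷ post
        split {v} v≢v₀ = ∈-++⁻ pre (subst (v ∈_) others≡ (∈-others⁺ v≢v₀))

        centre-above : ∀ {u} → g w ≤ g u → g u + 2 ≢ g v₀ + T
        centre-above w≤u e = <⇒≢ (≤-<-trans w≤u (m<m+n _ z<s)) (trans tight (sym e))

        centre-below : ∀ {v} → g v < g w → g v ≢ g v₀ + T
        centre-below v<w e = <⇒≢ v<w (trans e (sym tight))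

        with-edge : adj G w w′ ≡ true → g w′ ≡ g w + 2 → Σ (Fin n → Fin n → Fin 3) Admissible
        with-edge adj-ww′ w′≡w+2 =
          admissible-spoked
            (pairInner w w′ (λ w≡w′ → <⇒≢ w<w′ (cong g w≡w′)) adj-ww′ even
                       (All.head top≢v₀) (All.head (All.tail top≢v₀)))
            (w ∷ w′ ∷ post) unique-top top≢v₀ endpoint⇒top T T≡ lift-ok
          where
          even : (g w + g w′) % 2 ≡ 0
          even rewrite w′≡w+2 | m+[m+2]≡[m+1]*2 (g w) = m*n%n≡0 (g w + 1) 2
          endpoint⇒top : ∀ v → does (v ≟ w ⊎-dec v ≟ w′) ≡ true → v ∈ w ∷ w′ ∷ post
          endpoint⇒top v with v ≟ w | v ≟ w′
          ... | yes refl | _ = λ _ → here refl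
          ... | no _ | yes refl = λ _ → there (here refl)
          ... | no _ | no _ = λ ()
          T≡ : sum (map (λ v → toℕ (if does (v ≟ w ⊎-dec v ≟ w′) then 1F else 2F)) (w ∷ w′ ∷ post)) ≡ T
          T≡ = trans (cong₂ _+_ at-w (cong₂ _+_ at-w′ (sum-map-const post at-post))) (sym (*-suc 2 (length post)))
            where
            at-w : toℕ (if does (w ≟ w ⊎-dec w ≟ w′) then 1F else 2F) ≡ 1
            at-w rewrite dec-true (w ≟ w) refl = refl
            at-w′ : toℕ (if does (w′ ≟ w ⊎-dec w′ ≟ w′) then 1F else 2F) ≡ 1
            at-w′ rewrite dec-true (w′ ≟ w′) refl | ∨-zeroʳ (does (w′ ≟ w)) = refl
            at-post : All (λ v → toℕ (if does (v ≟ w ⊎-dec v ≟ w′) then 1F else 2F) ≡ 2) post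
            at-post = All.zipWith (λ (w≢v , w′≢v) → value (w≢v ∘ sym) (w′≢v ∘ sym))
                                  (All.tail (AllPairs.head unique-top) , AllPairs.head (AllPairs.tail unique-top))
              where
              value : ∀ {v} → v ≢ w → v ≢ w′ → toℕ (if does (v ≟ w ⊎-dec v ≟ w′) then 1F else 2F) ≡ 2
              value {v} v≢w v≢w′ rewrite dec-false (v ≟ w) v≢w | dec-false (v ≟ w′) v≢w′ = refl
          lift-ok : ProperLift (w ∷ w′ ∷ post) T
          lift-ok = record
            { cut        = λ _ v≢v₀ u∈top v∉top → ≤⇒≢+2 (<⇒≤ (<-≤-trans (below-w v≢v₀ v∉top) (w≤top u∈top)))
            ; centre-in  = λ u∈top → centre-above (w≤top u∈top)
            ; centre-out = λ v≢v₀ v∉top → centre-below (below-w v≢v₀ v∉top)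
            }
            where
            below-w : ∀ {v} → v ≢ v₀ → v ∉ w ∷ w′ ∷ post → g v < g w
            below-w v≢v₀ v∉top with split v≢v₀
            ... | inj₁ v∈pre = All.lookup pre<w v∈pre
            ... | inj₂ v∈top = ⊥-elim (v∉top v∈top)

        without-edge : (adj G w w′ ≡ true → g w′ ≢ g w + 2) → Σ (Fin n → Fin n → Fin 3) Admissible
        without-edge no-edge =
          admissible-spoked noInner (w ∷ post) unique-In In≢v₀ (λ _ ()) T
                    (sum-map-const (w ∷ post) (All.tabulate (λ _ → refl))) lift-ok
          where
          unique-In : Unique (w ∷ post)
          unique-In = All.tail (AllPairs.head unique-top) ∷ AllPairs.tail (AllPairs.tail unique-top)
          In≢v₀ : All (_≢ v₀) (w ∷ post)
          In≢v₀ = All.head top≢v₀ ∷ All.tail (All.tail top≢v₀)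
          w≤In : ∀ {u} → u ∈ w ∷ post → g w ≤ g u
          w≤In (here refl) = ≤-refl
          w≤In (there u∈post) = w≤top (there (there u∈post))
          outside : ∀ {v} → v ≢ v₀ → v ∉ w ∷ post → v ∈ pre ⊎ v ≡ w′
          outside v≢v₀ v∉In with split v≢v₀
          ... | inj₁ v∈pre = inj₁ v∈pre
          ... | inj₂ (here refl) = ⊥-elim (v∉In (here refl))
          ... | inj₂ (there (here refl)) = inj₂ refl
          ... | inj₂ (there (there v∈post)) = ⊥-elim (v∉In (there v∈post))
          cut : ∀ {u v} → adj G u v ≡ true → v ≢ v₀ → u ∈ w ∷ post → v ∉ w ∷ post → g v ≢ g u + 2
          cut {u} adj-uv v≢v₀ u∈In v∉In with outside v≢v₀ v∉In | u∈In
          ... | inj₁ v∈pre | _ = ≤⇒≢+2 (<⇒≤ (<-≤-trans (All.lookup pre<w v∈pre) (w≤In u∈In)))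
          ... | inj₂ refl | here refl = no-edge adj-uv
          ... | inj₂ refl | there u∈post = ≤⇒≢+2 (All.lookup w′≤post u∈post)
          lift-ok : ProperLift (w ∷ post) T
          lift-ok = record
            { cut        = cut
            ; centre-in  = λ u∈In → centre-above (w≤In u∈In)
            ; centre-out = λ v≢v₀ v∉In →
                [ centre-below ∘ All.lookup pre<w , (λ { refl e → <⇒≢ w<w′ (trans tight (sym e)) }) ]′
                (outside v≢v₀ v∉In)
            }

        admissible : Σ (Fin n → Fin n → Fin 3) Admissible
        admissible with adj G w w′ Bool.≟ true | g w′ ℕ.≟ g w + 2
        ... | yes adj-ww′ | yes w′≡w+2 = with-edge adj-ww′ w′≡w+2
        ... | yes _ | no w′≢w+2 = without-edge (λ _ → w′≢w+2)
        ... | no ¬adj | _ = without-edge (λ adj-ww′ → ⊥-elim (¬adj adj-ww′))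

      admissible-weighting : 2 ≤ length others → Σ (Fin n → Fin n → Fin 3) Admissible
      admissible-weighting 2≤∣others∣ with choose (g v₀) others-sorted 2≤∣others∣
      ... | balanced P Q others≡ balanced-PQ = balanced⇒admissible P Q others≡ balanced-PQ
      ... | pivot pre w w′ post others≡ tight pre<w w<w′ = Pivot.admissible pre w w′ post others≡ tight pre<w w<w′

two-besides : ∀ {n} → 3 ≤ n → (v : Fin n) → ∃₂ λ a b → a ≢ v × b ≢ v × a ≢ b
two-besides (s≤s (s≤s (s≤s _))) 0F = 1F , 2F , (λ ()) , (λ ()) , (λ ())
two-besides (s≤s (s≤s (s≤s _))) 1F = 0F , 2F , (λ ()) , (λ ()) , (λ ())
two-besides (s≤s (s≤s (s≤s _))) (suc (suc _)) = 0F , 1F , (λ ()) , (λ ()) , (λ ())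

lemma2 : (n : ℕ) → 3 ≤ n → (G : Graph n) → (v₀ : Fin n) → deg G v₀ ≡ n ∸ 1
    → (g : Fin n → ℕ)
    → (∀ u v → adj G v₀ u ≡ true → adj G v₀ v ≡ true → adj G u v ≡ true → g u ≢ g v)
    → Σ (Fin n → Fin n → Fin 3) λ h →
        (∀ u v → adj G u v ≡ true → h u v ≡ h v u)
      × (∀ u v → adj G u v ≡ true → u ≢ v₀ → v ≢ v₀ → (g u + g v) % 2 ≡ 0 → toℕ (h u v) ≤ 1)
      × (∀ u v → adj G u v ≡ true → u ≢ v₀ → v ≢ v₀ → (g u + g v) % 2 ≡ 1 → h u v ≡ zero)
      × (∀ v → adj G v₀ v ≡ true → (sh G h v ≡ 0 ⊎ sh G h v ≡ 2))
      × (∀ u v → adj G u v ≡ true → g u + sh G h u ≢ g v + sh G h v)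
lemma2 n 3≤n G v₀ deg≡ g proper-in-N with two-besides 3≤n v₀
... | a , b , a≢v₀ , b≢v₀ , a≢b =
  admissible-weighting G v₀ g univ proper
    (distinct-members (∈-others⁺ G v₀ g a≢v₀) (∈-others⁺ G v₀ g b≢v₀) a≢b)
  where
  univ : Universal G v₀
  univ = full-degree⇒universal G v₀ deg≡
  proper : ProperOffCentre G v₀ g
  proper u v adj-uv u≢v₀ v≢v₀ = proper-in-N u v (univ u u≢v₀) (univ v v≢v₀) adj-uv
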